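{- Let $P$ be a $\Sigma$-pattern with first symbol in $\Sigma$ and exactly one gap such that $\mathrm{T}(P)$ is completely additive, and suppose $|P|=nm$ with $n,m\ge2$. Then for every $i$ with $1\le i<n$ the arithmetic subsequence $\mathrm{T}(P)_{i,n}$ is constant.
   Context: $\Sigma$ is a finite cyclic group; gaps are bijections of $\Sigma$, $?$ the identity. For words $x,y$ over $\Sigma\cup\mathrm{S}_\Sigma$: $(a\,x)\langle y\rangle=a\,x\langle y\rangle$, $(f\,x)\langle b\,y\rangle=f(b)\,x\langle y\rangle$, $(f\,x)\langle g\,y\rangle=(f\circ g)\,x\langle y\rangle$. For $P$ with first symbol in $\Sigma$: $T_0=?^\omega$, $T_{i+1}=P^\omega\langle T_i\rangle$, $\mathrm{T}(P)=\lim T_i$, indexed by positive integers. Completely additive: $\sigma(1)=0$, $\sigma(nm)=\sigma(n)+\sigma(m)$. For $\sigma$ indexed by positive integers, $\sigma_{a,b}(j)=\sigma(a+b(j-1))$, $j\ge1$. -}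

module Defs where

open import Data.Nat using (ℕ; zero; suc; _+_; _*_; _∸_; _≤_; _<_)
open import Data.Nat.DivMod using (_mod_)
open import Data.Fin using (Fin; toℕ)
open import Data.Fin.Permutation using (Permutation′; _⟨$⟩ʳ_; _∘ₚ_)
  renaming (id to idₚ)
open import Data.Sum using (_⊎_; inj₁; inj₂)
open import Data.List using (List; []; _∷_; length; lookup)
open import Data.Product using (∃; Σ; _×_)
open import Relation.Binary.PropositionalEquality using (_≡_)

-- The finite cyclic group Σ, realised as ℤ/(suc k)ℤ on Fin (suc k).
Alph : ℕ → Set
Alph k = Fin (suc k)

_⊕_ : {k : ℕ} → Alph k → Alph k → Alph k
_⊕_ {k} a b = (toℕ a + toℕ b) mod (suc k)

𝟘 : {k : ℕ} → Alph k
𝟘 = Fin.zero where import Data.Fin as Fin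

-- Symbols: letters of Σ (inj₁) or gaps = bijections of Σ (inj₂).
Sym : ℕ → Set
Sym k = Alph k ⊎ Permutation′ (suc k)

Pattern : ℕ → Set
Pattern k = List (Sym k)

-- Infinite words, indexed from 0 (index 0 = position 1).
Word : ℕ → Set
Word k = ℕ → Sym k

gap? : {k : ℕ} → Sym k
gap? = inj₂ idₚ

-- filling one gap f with a symbol of y:
--   f⟨b⟩ = f(b),  f⟨g⟩ = f ∘ g  (note: π₁ ∘ₚ π₂ applies π₁ first)
fill : {k : ℕ} → Permutation′ (suc k) → Sym k → Sym k
fill f (inj₁ b) = inj₁ (f ⟨$⟩ʳ b)
fill f (inj₂ g) = inj₂ (g ∘ₚ f)

isGapℕ : {k : ℕ} → Sym k → ℕ
isGapℕ (inj₁ _) = 0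
isGapℕ (inj₂ _) = 1

gapsBefore : {k : ℕ} → Word k → ℕ → ℕ
gapsBefore x zero = 0
gapsBefore x (suc j) = gapsBefore x j + isGapℕ (x j)

-- x⟨y⟩ for infinite words: letters of x are kept, the (r+1)-th gap of x
-- is filled with the (r+1)-th symbol of y (unfolding of the recursive rules).
_⟨_⟩ : {k : ℕ} → Word k → Word k → Word k
(x ⟨ y ⟩) j with x j
... | inj₁ a = inj₁ a
... | inj₂ f = fill f (y (gapsBefore x j))

-- P^ω  (P is nonempty in all uses; the [] case is a dummy)
_^ω : {k : ℕ} → Pattern k → Word k
([] ^ω) j = gap?
((s ∷ ps) ^ω) j = lookup (s ∷ ps) (j mod suc (length ps))

Titer : {k : ℕ} → Pattern k → ℕ → Word k
Titer P zero = λ _ → gap?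
Titer P (suc i) = (P ^ω) ⟨ Titer P i ⟩

-- σ is T(P) = lim T_i, indexed by positive integers:
-- for each position j ≥ 1, T_i at position j is eventually the letter σ j.
IsTP : {k : ℕ} → Pattern k → (ℕ → Alph k) → Set
IsTP P σ = ∀ j → 1 ≤ j → ∃ λ N → ∀ i → N ≤ i → Titer P i (j ∸ 1) ≡ inj₁ (σ j)

FirstSymbolInΣ : {k : ℕ} → Pattern k → Set
FirstSymbolInΣ {k} P = ∃ λ (a : Alph k) → ∃ λ ps → P ≡ inj₁ a ∷ ps

countGaps : {k : ℕ} → Pattern k → ℕ
countGaps [] = 0
countGaps (s ∷ ps) = isGapℕ s + countGaps ps

CompletelyAdditive : {k : ℕ} → (ℕ → Alph k) → Set
CompletelyAdditive σ =
  (σ 1 ≡ 𝟘) × (∀ a b → 1 ≤ a → 1 ≤ b → σ (a * b) ≡ σ a ⊕ σ b)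

arith : {A : Set} → (ℕ → A) → ℕ → ℕ → ℕ → A
arith σ a b j = σ (a + b * (j ∸ 1))

IsConstantPos : {A : Set} → (ℕ → A) → Set
IsConstantPos τ = ∀ j j' → 1 ≤ j → 1 ≤ j' → τ j ≡ τ j'

module Submission where

-- Write σ = T(P) and L = |P| = n·m.
-- Letters of P^ω are never overwritten, so whenever P^ω carries a letter c at
-- index r, σ takes the value c at every position r+1+t·L.  Since P has only
-- one gap, at least one of the two distinct residues L-1 and m·i-1 (mod L)
-- carries a letter in P (m·i < n·m = L because i < n).  Choose the multiplier
-- M = L resp. M = m accordingly: then M·(i + n·t) ≡ M·i (mod L) for all t, so
-- σ(M) + σ(i + n·t) = σ(M·(i + n·t)) is the same letter c for every t, and
-- cancelling σ(M) in the cyclic group Σ shows σ(i + n·t) = σ(i).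

open import Defs
open import Data.Nat using (ℕ; suc; _+_; _*_; _∸_; _≤_; _<_; s≤s; z≤n; NonZero; _%_; >-nonZero)
open import Data.Nat.Properties
open import Data.Nat.DivMod
open import Data.Fin using (toℕ) renaming (zero to fz; suc to fs)
open import Data.Fin.Properties using (toℕ-injective; toℕ-fromℕ<; toℕ<n)
open import Data.List using (List; _∷_; length; lookup)
open import Data.Sum using (_⊎_; inj₁; inj₂)
open import Data.Sum.Properties using (inj₁-injective)
open import Data.Product using (∃; _,_)
open import Data.Empty using (⊥; ⊥-elim)
open import Relation.Binary.PropositionalEquality

toℕ-mod : ∀ a K .{{_ : NonZero K}} → toℕ (a mod K) ≡ a % K
toℕ-mod a K = toℕ-fromℕ< _

%-undo-+ : ∀ K c a .{{_ : NonZero K}} → c ≤ K → (K ∸ c + (c + a) % K) % K ≡ a % K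
%-undo-+ K c a c≤K = begin
  (K ∸ c + (c + a) % K) % K        ≡⟨ %-distribˡ-+ (K ∸ c) ((c + a) % K) K ⟩
  ((K ∸ c) % K + (c + a) % K % K) % K ≡⟨ cong (λ z → ((K ∸ c) % K + z) % K) (m%n%n≡m%n (c + a) K) ⟩
  ((K ∸ c) % K + (c + a) % K) % K  ≡⟨ %-distribˡ-+ (K ∸ c) (c + a) K ⟨
  (K ∸ c + (c + a)) % K            ≡⟨ cong (_% K) (+-assoc (K ∸ c) c a) ⟨
  (K ∸ c + c + a) % K              ≡⟨ cong (λ z → (z + a) % K) (m∸n+n≡m c≤K) ⟩
  (K + a) % K                      ≡⟨ cong (_% K) (+-comm K a) ⟩
  (a + K) % K                      ≡⟨ [m+n]%n≡m%n a K ⟩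
  a % K                            ∎
  where open ≡-Reasoning

⊕-cancelˡ : ∀ {k} (c a b : Alph k) → c ⊕ a ≡ c ⊕ b → a ≡ b
⊕-cancelˡ {k} c a b ca≡cb = toℕ-injective (begin
  toℕ a                                      ≡⟨ residue a ⟨
  (K ∸ toℕ c + (toℕ c + toℕ a) % K) % K       ≡⟨ cong (λ z → (K ∸ toℕ c + z) % K) sums ⟩
  (K ∸ toℕ c + (toℕ c + toℕ b) % K) % K       ≡⟨ residue b ⟩
  toℕ b                                      ∎)
  where
  open ≡-Reasoning
  K = suc k
  sums : (toℕ c + toℕ a) % K ≡ (toℕ c + toℕ b) % K
  sums = trans (sym (toℕ-mod (toℕ c + toℕ a) K)) (trans (cong toℕ ca≡cb) (toℕ-mod (toℕ c + toℕ b) K))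
  residue : ∀ (x : Alph k) → (K ∸ toℕ c + (toℕ c + toℕ x) % K) % K ≡ toℕ x
  residue x = trans (%-undo-+ K (toℕ c) (toℕ x) (<⇒≤ (toℕ<n c))) (m<n⇒m%n≡m (toℕ<n x))

additive-cancel : ∀ {k} {σ : ℕ → Alph k} → CompletelyAdditive σ
  → ∀ {M a b} → 1 ≤ M → 1 ≤ a → 1 ≤ b → σ (M * a) ≡ σ (M * b) → σ a ≡ σ b
additive-cancel {σ = σ} (_ , σ-mult) {M} {a} {b} M≥1 a≥1 b≥1 eq =
  ⊕-cancelˡ (σ M) (σ a) (σ b)
    (trans (sym (σ-mult M a M≥1 a≥1)) (trans eq (σ-mult M b M≥1 b≥1)))

no-gap-lookup : ∀ {k} (xs : List (Sym k)) q → countGaps xs ≡ 0 → isGapℕ (lookup xs q) ≡ 1 → ⊥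
no-gap-lookup (inj₁ _ ∷ xs) fz      _  ()
no-gap-lookup (inj₂ _ ∷ xs) fz      ()
no-gap-lookup (inj₁ _ ∷ xs) (fs q)  c  g = no-gap-lookup xs q c g
no-gap-lookup (inj₂ _ ∷ xs) (fs q)  ()

gap-index-unique : ∀ {k} (xs : List (Sym k)) p q → countGaps xs ≡ 1
  → isGapℕ (lookup xs p) ≡ 1 → isGapℕ (lookup xs q) ≡ 1 → p ≡ q
gap-index-unique (s ∷ xs)     fz     fz     _ _  _  = refl
gap-index-unique (inj₁ _ ∷ xs) fz     (fs q) _ () _
gap-index-unique (inj₂ _ ∷ xs) fz     (fs q) c _  gq = ⊥-elim (no-gap-lookup xs q (suc-injective c) gq)
gap-index-unique (inj₁ _ ∷ xs) (fs p) fz     _ _  ()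
gap-index-unique (inj₂ _ ∷ xs) (fs p) fz     c gp _  = ⊥-elim (no-gap-lookup xs p (suc-injective c) gp)
gap-index-unique (inj₁ _ ∷ xs) (fs p) (fs q) c gp gq = cong fs (gap-index-unique xs p q c gp gq)
gap-index-unique (inj₂ _ ∷ xs) (fs p) (fs q) c gp _  = ⊥-elim (no-gap-lookup xs p (suc-injective c) gp)

letter-or-gap : ∀ {k} (x : Sym k) → (∃ λ c → x ≡ inj₁ c) ⊎ isGapℕ x ≡ 1
letter-or-gap (inj₁ c) = inj₁ (c , refl)
letter-or-gap (inj₂ _) = inj₂ refl

⟨⟩-keeps-letter : ∀ {k} (x y : Word k) j a → x j ≡ inj₁ a → (x ⟨ y ⟩) j ≡ inj₁ a
⟨⟩-keeps-letter x y j a xj≡a rewrite xj≡a = refl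

module _ {k : ℕ} (s : Sym k) (ps : List (Sym k)) where
  private
    P = s ∷ ps
    L = length P

  ^ω-periodic : ∀ r t → (P ^ω) (r + t * L) ≡ (P ^ω) r
  ^ω-periodic r t = cong (lookup P) (toℕ-injective (begin
    toℕ ((r + t * L) mod L) ≡⟨ toℕ-mod (r + t * L) L ⟩
    (r + t * L) % L         ≡⟨ [m+kn]%n≡m%n r t L ⟩
    r % L                   ≡⟨ toℕ-mod r L ⟨
    toℕ (r mod L)           ∎))
    where open ≡-Reasoning

  ^ω-gap-unique : countGaps P ≡ 1 → ∀ {r r'} → r < L → r' < L
    → isGapℕ ((P ^ω) r) ≡ 1 → isGapℕ ((P ^ω) r') ≡ 1 → r ≡ r'
  ^ω-gap-unique one {r} {r'} r<L r'<L gr gr' = begin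
    r               ≡⟨ m<n⇒m%n≡m r<L ⟨
    r % L           ≡⟨ toℕ-mod r L ⟨
    toℕ (r mod L)   ≡⟨ cong toℕ (gap-index-unique P _ _ one gr gr') ⟩
    toℕ (r' mod L)  ≡⟨ toℕ-mod r' L ⟩
    r' % L          ≡⟨ m<n⇒m%n≡m r'<L ⟩
    r'              ∎
    where open ≡-Reasoning

  one-of-two-letters : countGaps P ≡ 1 → ∀ {r r'} → r < L → r' < L → r ≢ r'
    → (∃ λ c → (P ^ω) r ≡ inj₁ c) ⊎ (∃ λ c → (P ^ω) r' ≡ inj₁ c)
  one-of-two-letters one {r} {r'} r<L r'<L r≢r'
    with letter-or-gap ((P ^ω) r) | letter-or-gap ((P ^ω) r')
  ... | inj₁ letter | _           = inj₁ letter
  ... | inj₂ _      | inj₁ letter = inj₂ letter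
  ... | inj₂ gap    | inj₂ gap'   = ⊥-elim (r≢r' (^ω-gap-unique one r<L r'<L gap gap'))

  module _ {σ : ℕ → Alph k} (isTP : IsTP P σ) where

    TP-letter : ∀ {r c} → (P ^ω) r ≡ inj₁ c → σ (suc r) ≡ c
    TP-letter {r} {c} Pr≡c with isTP (suc r) (s≤s z≤n)
    ... | N , stable = inj₁-injective
      (trans (sym (stable (suc N) (n≤1+n N))) (⟨⟩-keeps-letter (P ^ω) (Titer P N) r c Pr≡c))

    TP-letter-periodic : ∀ {r c} → (P ^ω) r ≡ inj₁ c → ∀ t → σ (suc r + t * L) ≡ c
    TP-letter-periodic {r} Pr≡c t = TP-letter (trans (^ω-periodic r t) Pr≡c)

    equal-at-letter-multiples : CompletelyAdditive σ → ∀ {r c} → (P ^ω) r ≡ inj₁ c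
      → ∀ {M a b} u v → 1 ≤ M → 1 ≤ a → 1 ≤ b
      → M * a ≡ suc r + u * L → M * b ≡ suc r + v * L → σ a ≡ σ b
    equal-at-letter-multiples additive {r} {c} Pr≡c {M} {a} {b} u v M≥1 a≥1 b≥1 Ma Mb =
      additive-cancel additive M≥1 a≥1 b≥1 (begin
        σ (M * a)         ≡⟨ cong σ Ma ⟩
        σ (suc r + u * L) ≡⟨ TP-letter-periodic Pr≡c u ⟩
        c                 ≡⟨ TP-letter-periodic Pr≡c v ⟨
        σ (suc r + v * L) ≡⟨ cong σ Mb ⟨
        σ (M * b)         ∎)
      where open ≡-Reasoning

-- L·a = L + (a-1)·L: multiplying by L lands on the last residue L-1 mod L.
mul-last-residue : ∀ L a → 1 ≤ a → L * a ≡ L + (a ∸ 1) * L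
mul-last-residue L (suc a) _ = trans (*-suc L a) (cong (L +_) (*-comm L a))

-- m·(i + n·t) = (m·i - 1) + 1 + t·L when L = n·m: multiplying by m turns the
-- step n into the period L, keeping the residue m·i - 1.
mul-period-shift : ∀ m i n t {L} → 1 ≤ m * i → L ≡ n * m
  → m * (i + n * t) ≡ suc (m * i ∸ 1) + t * L
mul-period-shift m i n t mi≥1 refl = begin
  m * (i + n * t)          ≡⟨ solve 4 (λ m i n t → m :* (i :+ n :* t) := m :* i :+ t :* (n :* m)) refl m i n t ⟩
  m * i + t * (n * m)      ≡⟨ cong (_+ t * (n * m)) (suc-pred (m * i) {{>-nonZero mi≥1}}) ⟨
  suc (m * i ∸ 1) + t * (n * m) ∎
  where
  open ≡-Reasoning
  open import Data.Nat.Solver using (module +-*-Solver)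
  open +-*-Solver

mainTheorem12 : (k : ℕ) (P : Pattern k) (σ : ℕ → Alph k) (n m : ℕ)
    → FirstSymbolInΣ P
    → countGaps P ≡ 1
    → IsTP P σ
    → CompletelyAdditive σ
    → length P ≡ n * m
    → 2 ≤ n → 2 ≤ m
    → ∀ i → 1 ≤ i → i < n
    → IsConstantPos (arith σ i n)
mainTheorem12 k .(inj₁ a ∷ ps) σ n m (a , ps , refl) one isTP additive L≡nm _ 2≤m i 1≤i i<n j j' _ _ =
  trans (along (j ∸ 1)) (sym (along (j' ∸ 1)))
  where
  L : ℕ
  L = suc (length ps)
  m≥1 : 1 ≤ m
  m≥1 = ≤-trans (n≤1+n 1) 2≤m
  x≥1 : ∀ t → 1 ≤ i + n * t
  x≥1 t = ≤-trans 1≤i (m≤m+n i (n * t))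
  mi≥1 : 1 ≤ m * i
  mi≥1 = *-mono-≤ m≥1 1≤i
  -- m·i < n·m = L, so m·i - 1 is a residue distinct from the last one, L - 1.
  mi<L : m * i < L
  mi<L = subst (m * i <_) (trans (*-comm m n) (sym L≡nm)) (*-monoʳ-< m {{>-nonZero m≥1}} i<n)
  residues-differ : length ps ≢ m * i ∸ 1
  residues-differ eq = <-irrefl (trans (sym (suc-pred (m * i) {{>-nonZero mi≥1}})) (cong suc (sym eq))) mi<L
  -- σ(i + n·t) = σ(i) via the multiplier L or m, whichever lands on a letter.
  along : ∀ t → σ (i + n * t) ≡ σ (i + n * 0)
  along t with one-of-two-letters (inj₁ a) ps one (n<1+n (length ps))
                 (≤-trans (s≤s (m∸n≤m (m * i) 1)) mi<L) residues-differ
  ... | inj₁ (_ , last)  = equal-at-letter-multiples (inj₁ a) ps isTP additive last {M = L}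
          (i + n * t ∸ 1) (i + n * 0 ∸ 1) (s≤s z≤n) (x≥1 t) (x≥1 0)
          (mul-last-residue L _ (x≥1 t)) (mul-last-residue L _ (x≥1 0))
  ... | inj₂ (_ , inner) = equal-at-letter-multiples (inj₁ a) ps isTP additive inner
          t 0 m≥1 (x≥1 t) (x≥1 0) (mul-period-shift m i n t mi≥1 L≡nm) (mul-period-shift m i n 0 mi≥1 L≡nm)
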